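{- Let $k\ge 2$ and let ${\sf lcm}(k-1)$ denote the least common multiple of $1,2,\ldots,k-1$. Then the full transformation semigroup $T_k$ satisfies the identity $$(xy)^{k-2+{\sf lcm}(k-1)}(yx)^k(xy)^{k-1} = (xy)^{k-2}(yx)^k(xy)^{k-1+{\sf lcm}(k-1)},$$ whose length is $2\,{\sf lcm}(k-1)+6(k-1)$.
   Context: $T_k$ is the semigroup of all maps of $\{1,\ldots,k\}$ to itself under composition. An identity $(u,v)$ holds in $T_k$ if the images of $u$ and $v$ are equal for every assignment of elements of $T_k$ to the letters; its length is $\max(|u|,|v|)$. -}

module Defs where

open import Data.Nat using (ℕ; zero; suc; _+_; _*_; _∸_)
open import Data.Nat.LCM using (lcm)
open import Data.Fin using (Fin)
open import Data.List using (List; []; _∷_; _++_; length; replicate; concat)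
open import Function using (id; _∘′_)
open import Relation.Binary.PropositionalEquality using (_≡_)

T : ℕ → Set
T k = Fin k → Fin k

-- Product in T_k, written left-to-right (maps act on the right):
-- (f · g)(i) = g (f i), i.e. first apply f, then g.
_·_ : ∀ {k} → T k → T k → T k
f · g = g ∘′ f

_≈T_ : ∀ {k} → T k → T k → Set
f ≈T g = ∀ i → f i ≡ g i

-- Words over an alphabet A (semigroup words; the empty word is never used
-- below, it evaluates to the identity map).
Word : Set → Set
Word A = List A

eval : ∀ {A : Set} {k} → (A → T k) → Word A → T k
eval σ []       = id
eval σ (a ∷ w)  = σ a · eval σ w

HoldsIn : ∀ {A : Set} → ℕ → Word A → Word A → Set
HoldsIn {A} k u v = (σ : A → T k) → eval σ u ≈T eval σ v

identityLength : ∀ {A : Set} → Word A → Word A → ℕ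
identityLength u v = Data.Nat._⊔_ (length u) (length v)

lcmUpTo : ℕ → ℕ
lcmUpTo zero    = 1
lcmUpTo (suc n) = lcm (suc n) (lcmUpTo n)

_^w_ : ∀ {A : Set} → Word A → ℕ → Word A
w ^w n = concat (replicate n w)

data XY : Set where
  x y : XY

xy yx : Word XY
xy = x ∷ y ∷ []
yx = y ∷ x ∷ []

lhsW : ℕ → Word XY
lhsW k = (xy ^w ((k ∸ 2) + lcmUpTo (k ∸ 1))) ++ ((yx ^w k) ++ (xy ^w (k ∸ 1)))

rhsW : ℕ → Word XY
rhsW k = (xy ^w (k ∸ 2)) ++ ((yx ^w k) ++ (xy ^w ((k ∸ 1) + lcmUpTo (k ∸ 1))))

-- Write a = xy, b = yx and L = lcm(k-1), and follow the a-orbit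
-- p, a p, …, a^(k-1) p of a point p.  If it repeats, p has tail at most k-2
-- and period at most k-1, so a^(k-2+L) p = a^(k-2) p.  Otherwise the orbit
-- exhausts all k points and a^k p = a^j p for some j < k: j = 0 gives
-- a^k = 1, 0 < j < k-1 is again a short repeat, and j = k-1 makes a^(k-1)
-- constant with value a fixed point of a.  Hence, globally, either
--   (1) a^(k-2+L) = a^(k-2): both sides equal (xy)^(k-2) (yx)^k (xy)^(k-1);
--   (2) a^k = 1: then x is a bijection conjugating b to a, so b^k = 1 and
--       both sides are a^(2k-3+L); or
--   (3) a^(k-1) is constant: both sides equal its value.

module Submission where

open import Defs
open import Data.Nat using (ℕ; _≤_; _+_; _*_; _∸_)
open import Data.Product using (_×_)
open import Relation.Binary.PropositionalEquality using (_≡_)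

open import Data.Empty using (⊥-elim)
open import Data.Fin as Fin using (Fin; toℕ; punchOut)
open import Data.Fin.Properties as Finₚ
  using (any?; all?; ¬∀⟶∃¬; pigeonhole; punchOut-injective; <-cmp; toℕ<n)
open import Data.List using ([]; _∷_; _++_; length)
open import Data.List.Properties using (length-++)
open import Data.Nat using (zero; suc; s≤s; z≤n; _<_; _⊔_; s≤s⁻¹)
open import Data.Nat.Divisibility using (_∣_; divides; ∣-trans)
open import Data.Nat.GeneralisedArithmetic using (iterate)
open import Data.Nat.LCM using (m∣lcm[m,n]; n∣lcm[m,n])
open import Data.Nat.Properties
  using (+-commutativeSemigroup; +-assoc; +-identityʳ; m+[n∸m]≡n; <⇒≤; n<1+n;
         +-comm; ≤-trans; <-irrefl; m∸n≤m; m<n⇒0<n∸m; m≤n⇒m<n∨m≡n; ⊔-idem)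
open import Algebra.Properties.CommutativeSemigroup +-commutativeSemigroup
  using (xy∙z≈xz∙y; xy∙z≈x∙zy)
open import Data.Nat.Tactic.RingSolver using (solve-∀)
open import Data.Product using (∃; ∃₂; _,_)
open import Data.Sum using (_⊎_; inj₁; inj₂)
open import Function.Base using (_∘_)
open import Function.Definitions using (Injective)
open import Relation.Binary.Definitions using (DecidableEquality; tri<; tri≈; tri>)
open import Relation.Nullary using (¬_; Dec; yes; no)
open import Relation.Nullary.Decidable using (_×-dec_)
open import Relation.Binary.PropositionalEquality
  using (_≢_; refl; sym; trans; cong; cong₂; module ≡-Reasoning)
open ≡-Reasoning

_^_ : ∀ {A : Set} → (A → A) → ℕ → A → A
(f ^ m) p = iterate f p m

module _ {A : Set} (f : A → A) where

  ^-+ : ∀ m n p → (f ^ (m + n)) p ≡ (f ^ n) ((f ^ m) p)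
  ^-+ zero    n p = refl
  ^-+ (suc m) n p = ^-+ m n (f p)

  ^-comm : ∀ m n p → (f ^ m) ((f ^ n) p) ≡ (f ^ n) ((f ^ m) p)
  ^-comm m n p = begin
    (f ^ m) ((f ^ n) p) ≡⟨ ^-+ n m p ⟨
    (f ^ (n + m)) p     ≡⟨ cong (λ t → (f ^ t) p) (+-comm n m) ⟩
    (f ^ (m + n)) p     ≡⟨ ^-+ m n p ⟩
    (f ^ n) ((f ^ m) p) ∎

  ^-fixedPoint : ∀ {z} → f z ≡ z → ∀ m → (f ^ m) z ≡ z
  ^-fixedPoint fz zero    = refl
  ^-fixedPoint fz (suc m) = trans (cong (f ^ m) fz) (^-fixedPoint fz m)

  ^-periodic-* : ∀ {s c p} → (f ^ (s + c)) p ≡ (f ^ s) p →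
                 ∀ d → (f ^ (s + d * c)) p ≡ (f ^ s) p
  ^-periodic-* {s} {c} {p} per zero    = cong (λ t → (f ^ t) p) (+-identityʳ s)
  ^-periodic-* {s} {c} {p} per (suc d) = begin
    (f ^ (s + (c + d * c))) p       ≡⟨ cong (λ t → (f ^ t) p) (+-assoc s c (d * c)) ⟨
    (f ^ (s + c + d * c)) p         ≡⟨ ^-+ (s + c) (d * c) p ⟩
    (f ^ (d * c)) ((f ^ (s + c)) p) ≡⟨ cong (f ^ (d * c)) per ⟩
    (f ^ (d * c)) ((f ^ s) p)       ≡⟨ ^-+ s (d * c) p ⟨
    (f ^ (s + d * c)) p             ≡⟨ ^-periodic-* {s} {c} per d ⟩
    (f ^ s) p                       ∎

  ^-periodic : ∀ {s c L p} → (f ^ (s + c)) p ≡ (f ^ s) p → c ∣ L →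
               ∀ {m} → s ≤ m → (f ^ (m + L)) p ≡ (f ^ m) p
  ^-periodic {s} {c} {p = p} per (divides d refl) {m} s≤m = begin
    (f ^ (m + d * c)) p           ≡⟨ cong (λ t → (f ^ (t + d * c)) p) s+e≡m ⟨
    (f ^ (s + e + d * c)) p       ≡⟨ cong (λ t → (f ^ t) p) (xy∙z≈xz∙y s e (d * c)) ⟩
    (f ^ (s + d * c + e)) p       ≡⟨ ^-+ (s + d * c) e p ⟩
    (f ^ e) ((f ^ (s + d * c)) p) ≡⟨ cong (f ^ e) (^-periodic-* {s} {c} per d) ⟩
    (f ^ e) ((f ^ s) p)           ≡⟨ ^-+ s e p ⟨
    (f ^ (s + e)) p               ≡⟨ cong (λ t → (f ^ t) p) s+e≡m ⟩
    (f ^ m) p                     ∎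
    where
      e = m ∸ s
      s+e≡m : s + e ≡ m
      s+e≡m = m+[n∸m]≡n s≤m

  ^-intertwine : ∀ {B : Set} (g : B → B) (h : A → B) → (∀ p → g (h p) ≡ h (f p)) →
                 ∀ m p → (g ^ m) (h p) ≡ h ((f ^ m) p)
  ^-intertwine g h gh≡hf zero    p = refl
  ^-intertwine g h gh≡hf (suc m) p =
    trans (cong (g ^ m) (gh≡hf p)) (^-intertwine g h gh≡hf m (f p))

∣lcmUpTo : ∀ {c} N → 1 ≤ c → c ≤ N → c ∣ lcmUpTo N
∣lcmUpTo zero    1≤c c≤0 = ⊥-elim (<-irrefl refl (≤-trans 1≤c c≤0))
∣lcmUpTo (suc N) 1≤c c≤N+1 with m≤n⇒m<n∨m≡n c≤N+1
... | inj₂ refl      = m∣lcm[m,n] (suc N) (lcmUpTo N)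
... | inj₁ (s≤s c≤N) = ∣-trans (∣lcmUpTo N 1≤c c≤N) (n∣lcm[m,n] (suc N) (lcmUpTo N))

^-lcmUpTo-periodic : ∀ {A : Set} (f : A → A) {p s r N} → s < r → r ∸ s ≤ N →
                     (f ^ s) p ≡ (f ^ r) p →
                     ∀ {m} → s ≤ m → (f ^ (m + lcmUpTo N)) p ≡ (f ^ m) p
^-lcmUpTo-periodic f {p} {s} {r} {N} s<r r-s≤N fs≡fr =
  ^-periodic f per (∣lcmUpTo N (m<n⇒0<n∸m s<r) r-s≤N)
  where
    per : (f ^ (s + (r ∸ s))) p ≡ (f ^ s) p
    per = trans (cong (λ t → (f ^ t) p) (m+[n∸m]≡n (<⇒≤ s<r))) (sym fs≡fr)

collision-or-injective : ∀ {m} {B : Set} → DecidableEquality B → (f : Fin m → B) →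
                         (∃₂ λ i j → i Fin.< j × f i ≡ f j) ⊎ Injective _≡_ _≡_ f
collision-or-injective _≟_ f
  with any? (λ i → any? (λ j → (i Finₚ.<? j) ×-dec (f i ≟ f j)))
... | yes (i , j , i<j , fi≡fj) = inj₁ (i , j , i<j , fi≡fj)
... | no no-collision           = inj₂ injective
  where
    injective : Injective _≡_ _≡_ f
    injective {i} {j} fi≡fj with <-cmp i j
    ... | tri< i<j _ _ = ⊥-elim (no-collision (i , j , i<j , fi≡fj))
    ... | tri≈ _ i≡j _ = i≡j
    ... | tri> _ _ j<i = ⊥-elim (no-collision (j , i , j<i , sym fi≡fj))

-- A point q missed by f would let f, followed by punching out q, inject
-- Fin (suc m) into Fin m.
injective⇒surjective : ∀ {m} (f : Fin m → Fin m) → Injective _≡_ _≡_ f →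
                       ∀ q → ∃ λ p → f p ≡ q
injective⇒surjective {zero}  f f-injective ()
injective⇒surjective {suc m} f f-injective q with any? (λ p → f p Finₚ.≟ q)
... | yes hit = hit
... | no miss = ⊥-elim (no-collision (pigeonhole (n<1+n m) (λ p → punchOut (missed p))))
  where
    missed : ∀ p → q ≢ f p
    missed p q≡fp = miss (p , sym q≡fp)
    no-collision : ¬ (∃₂ λ i j → i Fin.< j × punchOut (missed i) ≡ punchOut (missed j))
    no-collision (i , j , i<j , eq) =
      Finₚ.<-irrefl (f-injective (punchOut-injective (missed i) (missed j) eq)) i<j

-- Here k = 2 + n, so a ^ suc n is a^(k-1) and L = lcm(k-1).
module _ (n : ℕ) (a : T (2 + n)) where

  private
    L = lcmUpTo (suc n)

  Stable : Fin (2 + n) → Set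
  Stable p = (a ^ (n + L)) p ≡ (a ^ n) p

  data Trichotomy (R : Set) : Set where
    power-identity : (∀ p → (a ^ (2 + n)) p ≡ p) → Trichotomy R
    power-constant : ∀ z → a z ≡ z → (∀ p → (a ^ suc n) p ≡ z) → Trichotomy R
    stable         : R → Trichotomy R

  orbit : Fin (2 + n) → Fin (2 + n) → Fin (2 + n)
  orbit p u = (a ^ toℕ u) p

  covering-orbit-trichotomy : ∀ p → (∀ q → ∃ λ u → orbit p u ≡ q) →
                              Trichotomy (Stable p)
  covering-orbit-trichotomy p enumerates with enumerates ((a ^ (2 + n)) p)
  ... | Fin.zero , p≡a^kp = power-identity a^k≗id
    where
      a^k≗id : ∀ q → (a ^ (2 + n)) q ≡ q
      a^k≗id q with u , refl ← enumerates q = begin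
        (a ^ (2 + n)) ((a ^ toℕ u) p) ≡⟨ ^-comm a (2 + n) (toℕ u) p ⟩
        (a ^ toℕ u) ((a ^ (2 + n)) p) ≡⟨ cong (a ^ toℕ u) p≡a^kp ⟨
        (a ^ toℕ u) p                 ∎
  ... | Fin.suc j , a^[1+j]p≡a^kp with m≤n⇒m<n∨m≡n (s≤s⁻¹ (toℕ<n j))
  ...   | inj₁ j<n =
    stable (^-lcmUpTo-periodic a (s≤s (toℕ<n j)) (m∸n≤m (suc n) (toℕ j))
                               a^[1+j]p≡a^kp j<n)
  ...   | inj₂ j≡n = power-constant z az≡z a^[k-1]≗z
    where
      z = (a ^ suc n) p
      az≡z : a z ≡ z
      az≡z = begin
        a ((a ^ suc n) p)       ≡⟨ ^-comm a 1 (suc n) p ⟩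
        (a ^ (2 + n)) p         ≡⟨ a^[1+j]p≡a^kp ⟨
        (a ^ suc (toℕ j)) p     ≡⟨ cong (λ t → (a ^ suc t) p) j≡n ⟩
        z                       ∎
      a^[k-1]≗z : ∀ q → (a ^ suc n) q ≡ z
      a^[k-1]≗z q with u , refl ← enumerates q = begin
        (a ^ suc n) ((a ^ toℕ u) p) ≡⟨ ^-comm a (suc n) (toℕ u) p ⟩
        (a ^ toℕ u) z               ≡⟨ ^-fixedPoint a az≡z (toℕ u) ⟩
        z                           ∎

  orbit-trichotomy : ∀ p → Trichotomy (Stable p)
  orbit-trichotomy p with collision-or-injective Finₚ._≟_ (orbit p)
  ... | inj₁ (u , v , u<v , collision) =
    stable (^-lcmUpTo-periodic a u<v (≤-trans (m∸n≤m (toℕ v) (toℕ u)) v≤n+1)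
                               collision u≤n)
    where
      v≤n+1 : toℕ v ≤ suc n
      v≤n+1 = s≤s⁻¹ (toℕ<n v)
      u≤n : toℕ u ≤ n
      u≤n = s≤s⁻¹ (≤-trans u<v v≤n+1)
  ... | inj₂ orbit-injective =
    covering-orbit-trichotomy p (injective⇒surjective (orbit p) orbit-injective)

  stable? : ∀ p → Dec (Stable p)
  stable? p = (a ^ (n + L)) p Finₚ.≟ (a ^ n) p

  trichotomy : Trichotomy (∀ p → Stable p)
  trichotomy with all? stable?
  ... | yes all-stable = stable all-stable
  ... | no not-all-stable with p , p-unstable ← ¬∀⟶∃¬ _ _ stable? not-all-stable
                          with orbit-trichotomy p
  ...   | power-identity a^k≗id           = power-identity a^k≗id
  ...   | power-constant z az≡z a^[k-1]≗z = power-constant z az≡z a^[k-1]≗z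
  ...   | stable p-stable                 = ⊥-elim (p-unstable p-stable)

power-identity⇒injective : ∀ {m} (X Y : T m) e →
                           (∀ p → ((X · Y) ^ suc e) p ≡ p) → Injective _≡_ _≡_ X
power-identity⇒injective X Y e [XY]^e≗id {u} {v} Xu≡Xv = begin
  u                       ≡⟨ [XY]^e≗id u ⟨
  ((X · Y) ^ e) (Y (X u)) ≡⟨ cong (λ t → ((X · Y) ^ e) (Y t)) Xu≡Xv ⟩
  ((X · Y) ^ e) (Y (X v)) ≡⟨ [XY]^e≗id v ⟩
  v                       ∎

-- On a finite set X is then bijective, and it conjugates YX to XY.
power-identity-swap : ∀ {m} (X Y : T m) e →
                      (∀ p → ((X · Y) ^ e) p ≡ p) → ∀ q → ((Y · X) ^ e) q ≡ q
power-identity-swap X Y zero    _          q = refl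
power-identity-swap X Y (suc e) [XY]^e≗id q
  with p , refl ← injective⇒surjective X (power-identity⇒injective X Y e [XY]^e≗id) q
  = begin
    ((Y · X) ^ suc e) (X p) ≡⟨ ^-intertwine (X · Y) (Y · X) X (λ _ → refl) (suc e) p ⟩
    X (((X · Y) ^ suc e) p) ≡⟨ cong X ([XY]^e≗id p) ⟩
    X p                     ∎

module _ (n : ℕ) (X Y : T (2 + n)) where

  private
    a b : T (2 + n)
    a = X · Y
    b = Y · X
    L = lcmUpTo (suc n)

  transformation-identity : ∀ i → (a ^ suc n) ((b ^ (2 + n)) ((a ^ (n + L)) i))
                                ≡ (a ^ (suc n + L)) ((b ^ (2 + n)) ((a ^ n) i))
  transformation-identity i with trichotomy n a
  ... | power-identity a^k≗id = begin
    (a ^ suc n) ((b ^ (2 + n)) ((a ^ (n + L)) i)) ≡⟨ cong (a ^ suc n) (b^k≗id _) ⟩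
    (a ^ suc n) ((a ^ (n + L)) i)                 ≡⟨ ^-+ a (n + L) (suc n) i ⟨
    (a ^ (n + L + suc n)) i                       ≡⟨ cong (λ t → (a ^ t) i) (xy∙z≈x∙zy n L _) ⟩
    (a ^ (n + (suc n + L))) i                     ≡⟨ ^-+ a n (suc n + L) i ⟩
    (a ^ (suc n + L)) ((a ^ n) i)                 ≡⟨ cong (a ^ (suc n + L)) (b^k≗id _) ⟨
    (a ^ (suc n + L)) ((b ^ (2 + n)) ((a ^ n) i)) ∎
    where
      b^k≗id : ∀ q → (b ^ (2 + n)) q ≡ q
      b^k≗id = power-identity-swap X Y (2 + n) a^k≗id
  ... | power-constant z az≡z a^[k-1]≗z = begin
    (a ^ suc n) ((b ^ (2 + n)) ((a ^ (n + L)) i)) ≡⟨ a^[k-1]≗z _ ⟩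
    z                                             ≡⟨ ^-fixedPoint a az≡z L ⟨
    (a ^ L) z                                     ≡⟨ cong (a ^ L) (a^[k-1]≗z q) ⟨
    (a ^ L) ((a ^ suc n) q)                       ≡⟨ ^-+ a (suc n) L q ⟨
    (a ^ (suc n + L)) q                           ∎
    where
      q = (b ^ (2 + n)) ((a ^ n) i)
  ... | stable a-stable = begin
    (a ^ suc n) ((b ^ (2 + n)) ((a ^ (n + L)) i)) ≡⟨ cong ((a ^ suc n) ∘ (b ^ (2 + n))) (a-stable i) ⟩
    (a ^ n) (a q)                                 ≡⟨ a-stable (a q) ⟨
    (a ^ (suc n + L)) q                           ∎
    where
      q = (b ^ (2 + n)) ((a ^ n) i)

module _ {A : Set} where

  eval-++ : ∀ {k} (σ : A → T k) u v i → eval σ (u ++ v) i ≡ eval σ v (eval σ u i)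
  eval-++ σ []      v i = refl
  eval-++ σ (c ∷ u) v i = eval-++ σ u v (σ c i)

  eval-^w : ∀ {k} (σ : A → T k) w m i → eval σ (w ^w m) i ≡ (eval σ w ^ m) i
  eval-^w σ w zero    i = refl
  eval-^w σ w (suc m) i = trans (eval-++ σ w (w ^w m) i) (eval-^w σ w m (eval σ w i))

  length-^w : ∀ (w : Word A) m → length (w ^w m) ≡ m * length w
  length-^w w zero    = refl
  length-^w w (suc m) = trans (length-++ w) (cong (length w +_) (length-^w w m))

  eval-^w-++-^w-++-^w : ∀ {k} (σ : A → T k) u v w l m r i →
    eval σ ((u ^w l) ++ ((v ^w m) ++ (w ^w r))) i
      ≡ (eval σ w ^ r) ((eval σ v ^ m) ((eval σ u ^ l) i))
  eval-^w-++-^w-++-^w σ u v w l m r i = begin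
    eval σ ((u ^w l) ++ ((v ^w m) ++ (w ^w r))) i
      ≡⟨ eval-++ σ (u ^w l) _ i ⟩
    eval σ ((v ^w m) ++ (w ^w r)) (eval σ (u ^w l) i)
      ≡⟨ eval-++ σ (v ^w m) _ _ ⟩
    eval σ (w ^w r) (eval σ (v ^w m) (eval σ (u ^w l) i))
      ≡⟨ eval-^w σ w r _ ⟩
    (eval σ w ^ r) (eval σ (v ^w m) (eval σ (u ^w l) i))
      ≡⟨ cong (eval σ w ^ r) (eval-^w σ v m _) ⟩
    (eval σ w ^ r) ((eval σ v ^ m) (eval σ (u ^w l) i))
      ≡⟨ cong (λ t → (eval σ w ^ r) ((eval σ v ^ m) t)) (eval-^w σ u l i) ⟩
    (eval σ w ^ r) ((eval σ v ^ m) ((eval σ u ^ l) i))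
      ∎

  length-^w-++-^w-++-^w : ∀ (u v w : Word A) l m r →
    length ((u ^w l) ++ ((v ^w m) ++ (w ^w r))) ≡ l * length u + (m * length v + r * length w)
  length-^w-++-^w-++-^w u v w l m r =
    trans (length-++ (u ^w l))
      (cong₂ _+_ (length-^w u l)
        (trans (length-++ (v ^w m)) (cong₂ _+_ (length-^w v m) (length-^w w r))))

module _ (n : ℕ) where

  private
    L = lcmUpTo (suc n)

  holdsIn-lhsW-rhsW : HoldsIn (2 + n) (lhsW (2 + n)) (rhsW (2 + n))
  holdsIn-lhsW-rhsW σ i = begin
    eval σ (lhsW (2 + n)) i
      ≡⟨ eval-^w-++-^w-++-^w σ xy yx xy (n + L) (2 + n) (suc n) i ⟩
    (a ^ suc n) ((b ^ (2 + n)) ((a ^ (n + L)) i))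
      ≡⟨ transformation-identity n (σ x) (σ y) i ⟩
    (a ^ (suc n + L)) ((b ^ (2 + n)) ((a ^ n) i))
      ≡⟨ eval-^w-++-^w-++-^w σ xy yx xy n (2 + n) (suc n + L) i ⟨
    eval σ (rhsW (2 + n)) i
      ∎
    where
      a = eval σ xy
      b = eval σ yx

  identityLength-lhsW-rhsW : identityLength (lhsW (2 + n)) (rhsW (2 + n)) ≡ 2 * L + 6 * suc n
  identityLength-lhsW-rhsW = trans
    (cong₂ _⊔_
      (trans (length-^w-++-^w-++-^w xy yx xy (n + L) (2 + n) (suc n)) (lhs-arithmetic n L))
      (trans (length-^w-++-^w-++-^w xy yx xy n (2 + n) (suc n + L)) (rhs-arithmetic n L)))
    (⊔-idem _)
    where
      lhs-arithmetic : ∀ m l → (m + l) * 2 + ((2 + m) * 2 + suc m * 2) ≡ 2 * l + 6 * suc m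
      lhs-arithmetic = solve-∀
      rhs-arithmetic : ∀ m l → m * 2 + ((2 + m) * 2 + (suc m + l) * 2) ≡ 2 * l + 6 * suc m
      rhs-arithmetic = solve-∀

theorem1 : (k : ℕ) → 2 ≤ k →
    HoldsIn k (lhsW k) (rhsW k)
      × identityLength (lhsW k) (rhsW k) ≡ 2 * lcmUpTo (k ∸ 1) + 6 * (k ∸ 1)
theorem1 (suc (suc n)) (s≤s (s≤s z≤n)) = holdsIn-lhsW-rhsW n , identityLength-lhsW-rhsW n
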